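{- Assume the Schinzel Hypothesis over $\mathbb{Z}$ holds: whenever $R_1,\dots,R_t\in\mathbb{Z}[T]$ are irreducible polynomials whose product has no fixed divisor with respect to $T$, there exist infinitely many integers $m$ such that $R_1(m),\dots,R_t(m)$ are all prime numbers. Let $P_1,\dots,P_s\in\mathbb{Z}[T]$ be irreducible polynomials such that the product $P_1\cdots P_s$ has no fixed divisor with respect to $T$. Then for any sequence $(d_m)_{m\geq 1}$ of integers $d_m\geq 1$ there exists a sequence $(M_m)_{m\geq 1}$ of polynomials $M_m\in\mathbb{Z}[T]$ with $\deg M_m=d_m$ such that for every $m\geq 1$, there are infinitely many integers $N$ among the values at integers of the polynomial $M_m\circ\cdots\circ M_2\circ M_1$ such that $P_1(N),\dots,P_s(N)$ are all prime numbers.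
   Context: For $P\in\mathbb{Z}[T]$, an integer $a\notin\{0,1,-1\}$ is a fixed divisor of $P$ with respect to $T$ if $a$ divides $P(m)$ for every $m\in\mathbb{Z}$. -}

module Defs where

open import Data.Nat as ℕ using (ℕ; zero; suc)
open import Data.Nat.Primality using (Prime)
open import Data.Integer as ℤ using (ℤ; +_; -[1+_]; ∣_∣)
open import Data.Integer.Divisibility using (_∣_)
open import Data.List using (List; []; _∷_; map)
open import Data.Fin using (Fin)
import Data.Fin as Fin
open import Data.Product using (Σ; ∃; _×_)
open import Data.Sum using (_⊎_)
open import Relation.Binary.PropositionalEquality using (_≡_; _≢_)
open import Relation.Nullary using (¬_)

-- Polynomials in ℤ[T] as coefficient lists, lowest degree first.
-- Trailing zeros are allowed; all notions below only depend on the
-- coefficient function, i.e. on the polynomial itself.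
Poly : Set
Poly = List ℤ

coeff : Poly → ℕ → ℤ
coeff []       _       = + 0
coeff (c ∷ cs) zero    = c
coeff (c ∷ cs) (suc k) = coeff cs k

_≈ₚ_ : Poly → Poly → Set
p ≈ₚ q = ∀ k → coeff p k ≡ coeff q k

eval : Poly → ℤ → ℤ
eval []       x = + 0
eval (c ∷ cs) x = c ℤ.+ x ℤ.* eval cs x

infixl 6 _+ₚ_
infixl 7 _*ₚ_

_+ₚ_ : Poly → Poly → Poly
[]      +ₚ q       = q
(a ∷ p) +ₚ []      = a ∷ p
(a ∷ p) +ₚ (b ∷ q) = (a ℤ.+ b) ∷ (p +ₚ q)

_*ₚ_ : Poly → Poly → Poly
[]      *ₚ q = []
(a ∷ p) *ₚ q = map (a ℤ.*_) q +ₚ (+ 0 ∷ (p *ₚ q))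

compose : Poly → Poly → Poly
compose []       q = []
compose (c ∷ cs) q = (c ∷ []) +ₚ (q *ₚ compose cs q)

prodₚ : ∀ {s} → (Fin s → Poly) → Poly
prodₚ {zero}  P = + 1 ∷ []
prodₚ {suc s} P = P Fin.zero *ₚ prodₚ (λ i → P (Fin.suc i))

HasDegree : Poly → ℕ → Set
HasDegree p d = (coeff p d ≢ + 0) × (∀ k → d ℕ.< k → coeff p k ≡ + 0)

IsUnit : Poly → Set
IsUnit p = (coeff p 0 ≡ + 1 ⊎ coeff p 0 ≡ -[1+ 0 ]) × (∀ k → 0 ℕ.< k → coeff p k ≡ + 0)

Irreducible : Poly → Set
Irreducible p =
  ¬ (p ≈ₚ []) × ¬ IsUnit p × (∀ a b → p ≈ₚ (a *ₚ b) → IsUnit a ⊎ IsUnit b)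

FixedDivisor : ℤ → Poly → Set
FixedDivisor a P =
  a ≢ + 0 × a ≢ + 1 × a ≢ -[1+ 0 ] × (∀ m → a ∣ eval P m)

NoFixedDivisor : Poly → Set
NoFixedDivisor P = ∀ a → ¬ FixedDivisor a P

-- an integer is a prime number (up to sign)
IsPrimeℤ : ℤ → Set
IsPrimeℤ z = Prime ∣ z ∣

InfiniteSet : (ℤ → Set) → Set
InfiniteSet S = ∀ (B : ℕ) → ∃ λ N → S N × B ℕ.< ∣ N ∣

SchinzelHypothesis : Set
SchinzelHypothesis =
  ∀ (t : ℕ) (R : Fin t → Poly) →
  (∀ i → Irreducible (R i)) →
  NoFixedDivisor (prodₚ R) →
  InfiniteSet (λ m → ∀ i → IsPrimeℤ (eval (R i) m))

-- iterated composition, 0-indexed: M is the sequence (M_1, M_2, …) with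
-- M k standing for M_{k+1};  iterComp M m = M_{m+1} ∘ ⋯ ∘ M_1
iterComp : (ℕ → Poly) → ℕ → Poly
iterComp M zero    = M zero
iterComp M (suc m) = compose (M (suc m)) (iterComp M m)

{-# OPTIONS --safe #-}
-- The composites are built one factor at a time. Given the composite Q so far, put
-- W = Q^d and look for an offset a such that the polynomials F i = P i (W + a) are
-- irreducible and their product has no fixed divisor; Schinzel's hypothesis for the F i
-- then gives infinitely many values N = W k + a with every P i N prime, and these N are
-- unbounded because |y| ≤ |Q y| + C along the whole construction.
--
-- The offset a is itself produced by Schinzel's hypothesis, applied to the shifts
-- P i (T + W xₖ) at K sample points xₖ = (k+1)·L!, so that every F i is prime at every xₖ.
-- A polynomial prime at more than 4·(deg + 1) points is irreducible: in a factorisation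
-- one factor is ±1 at more than 2·(deg + 1) points, hence constant. Likewise a fixed prime
-- divisor q of the product of the F i would make some F i the constant ±q, and then P i
-- would be ±q on the infinite image of W + a. The shifts have no fixed prime divisor either:
-- a prime q ≤ L divides every xₖ, so modulo q the shifts of P i all agree with P i (T + W 0),
-- while for q > L some shift would have more roots modulo q than its degree. Finally the
-- shifts are irreducible because, like the P i, they take infinitely many prime values.
module Submission where

open import Defs
open import Data.Empty using (⊥; ⊥-elim)
open import Data.Fin as Fin using (Fin; toℕ; remQuot; combine)
import Data.Fin.Properties as Finₚ
open import Data.Integer as ℤ using (ℤ; +_; -[1+_]; ∣_∣; _+_; _*_; _-_; -_; _^_)
open import Data.Integer.Divisibility.Signed
  using (_∣_; divides; ∣m⇒∣-m; ∣m∣n⇒∣m+n; ∣m∣n⇒∣m-n; ∣m+n∣m⇒∣n; ∣n⇒∣m*n; ∣m⇒∣m*n; 0∣⇒≡0; ∣m∣∣m; ∣⇒∣ᵤ; ∣ᵤ⇒∣)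
import Data.Integer.Properties as ℤₚ
open import Data.Integer.Tactic.RingSolver using (solve-∀)
open import Data.List using (List; []; _∷_; map; length; take; tabulate)
open import Data.List.Properties using (length-map; length-tabulate; length-take)
open import Data.List.Relation.Binary.Sublist.Propositional using (_⊆_; []; _∷_; _∷ʳ_; ⊆-trans)
open import Data.List.Relation.Binary.Sublist.Propositional.Properties using (All-resp-⊆)
open import Data.List.Relation.Unary.All as All using (All; []; _∷_)
import Data.List.Relation.Unary.All.Properties as All
open import Data.List.Relation.Unary.AllPairs as AllPairs using (AllPairs; []; _∷_)
import Data.List.Relation.Unary.AllPairs.Properties as AllPairs
open import Data.List.Relation.Unary.Unique.Propositional using (Unique)
import Data.List.Relation.Unary.Unique.Propositional.Properties as Unique
open import Data.Nat as ℕ using (ℕ; zero; suc; _≤_; _<_; z≤n; s≤s; _⊔_; _!)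
import Data.Nat.Divisibility as ℕᵈ
open import Data.Nat.ListAction using (product)
open import Data.Nat.Primality
  using (Prime; euclidsLemma; prime⇒irreducible; prime⇒nonZero; ¬prime[0]; ¬prime[1])
open import Data.Nat.Primality.Factorisation using (factorise)
import Data.Nat.Properties as ℕₚ
open import Data.Product using (Σ; ∃; ∃₂; _×_; _,_; proj₁; proj₂; uncurry; map₂)
open import Data.Sum using (_⊎_; inj₁; inj₂; [_,_]′)
open import Data.Unit using (⊤; tt)
open import Function using (id; _∘_)
open import Relation.Binary.PropositionalEquality
  using (_≡_; _≢_; refl; sym; trans; cong; cong₂; subst; module ≡-Reasoning)
open import Relation.Nullary using (¬_; yes; no)

-- Evaluation and lengths

eval-const : ∀ a x → eval (a ∷ []) x ≡ a
eval-const a x = trans (cong (_+_ a) (ℤₚ.*-zeroʳ x)) (ℤₚ.+-identityʳ a)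

eval-+ₚ : ∀ p q x → eval (p +ₚ q) x ≡ eval p x + eval q x
eval-+ₚ []      q       x = sym (ℤₚ.+-identityˡ _)
eval-+ₚ (a ∷ p) []      x = sym (ℤₚ.+-identityʳ _)
eval-+ₚ (a ∷ p) (b ∷ q) x =
  trans (cong (λ v → a + b + x * v) (eval-+ₚ p q x)) (shuffle a b x (eval p x) (eval q x))
  where
  shuffle : ∀ a b x u v → a + b + x * (u + v) ≡ a + x * u + (b + x * v)
  shuffle = solve-∀

eval-scale : ∀ a q x → eval (map (a *_) q) x ≡ a * eval q x
eval-scale a []      x = sym (ℤₚ.*-zeroʳ a)
eval-scale a (b ∷ q) x =
  trans (cong (λ v → a * b + x * v) (eval-scale a q x)) (shuffle a b x (eval q x))
  where
  shuffle : ∀ a b x u → a * b + x * (a * u) ≡ a * (b + x * u)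
  shuffle = solve-∀

eval-*ₚ : ∀ p q x → eval (p *ₚ q) x ≡ eval p x * eval q x
eval-*ₚ []      q x = refl
eval-*ₚ (a ∷ p) q x = begin
  eval (map (a *_) q +ₚ (+ 0 ∷ p *ₚ q)) x
    ≡⟨ eval-+ₚ (map (a *_) q) _ x ⟩
  eval (map (a *_) q) x + (+ 0 + x * eval (p *ₚ q) x)
    ≡⟨ cong₂ (λ u v → u + (+ 0 + x * v)) (eval-scale a q x) (eval-*ₚ p q x) ⟩
  a * eval q x + (+ 0 + x * (eval p x * eval q x))
    ≡⟨ shuffle a x (eval p x) (eval q x) ⟩
  (a + x * eval p x) * eval q x
    ∎
  where
  open ≡-Reasoning
  shuffle : ∀ a x u v → a * v + (+ 0 + x * (u * v)) ≡ (a + x * u) * v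
  shuffle = solve-∀

eval-compose : ∀ p q x → eval (compose p q) x ≡ eval p (eval q x)
eval-compose []       q x = refl
eval-compose (c ∷ cs) q x = begin
  eval ((c ∷ []) +ₚ q *ₚ compose cs q) x
    ≡⟨ eval-+ₚ (c ∷ []) (q *ₚ compose cs q) x ⟩
  eval (c ∷ []) x + eval (q *ₚ compose cs q) x
    ≡⟨ cong₂ _+_ (eval-const c x) (eval-*ₚ q (compose cs q) x) ⟩
  c + eval q x * eval (compose cs q) x
    ≡⟨ cong (λ v → c + eval q x * v) (eval-compose cs q x) ⟩
  c + eval q x * eval cs (eval q x)
    ∎
  where open ≡-Reasoning

eval-≈ₚ[] : ∀ p → p ≈ₚ [] → ∀ x → eval p x ≡ + 0
eval-≈ₚ[] []      p≈0 x = refl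
eval-≈ₚ[] (a ∷ p) p≈0 x = begin
  a + x * eval p x   ≡⟨ cong₂ (λ u v → u + x * v) (p≈0 0) (eval-≈ₚ[] p (λ k → p≈0 (suc k)) x) ⟩
  + 0 + x * + 0      ≡⟨ cong (_+_ (+ 0)) (ℤₚ.*-zeroʳ x) ⟩
  + 0                ∎
  where open ≡-Reasoning

eval-≈ₚ : ∀ p q → p ≈ₚ q → ∀ x → eval p x ≡ eval q x
eval-≈ₚ []      q       p≈q x = sym (eval-≈ₚ[] q (λ k → sym (p≈q k)) x)
eval-≈ₚ (a ∷ p) []      p≈q x = eval-≈ₚ[] (a ∷ p) p≈q x
eval-≈ₚ (a ∷ p) (b ∷ q) p≈q x =
  cong₂ (λ u v → u + x * v) (p≈q 0) (eval-≈ₚ p q (λ k → p≈q (suc k)) x)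

length-+ₚ : ∀ p q → length (p +ₚ q) ≡ length p ⊔ length q
length-+ₚ []      q       = refl
length-+ₚ (a ∷ p) []      = refl
length-+ₚ (a ∷ p) (b ∷ q) = cong suc (length-+ₚ p q)

length-+ₚ-const : ∀ p a → length (p +ₚ (a ∷ [])) ≤ suc (length p)
length-+ₚ-const p a = subst (_≤ suc (length p)) (sym (length-+ₚ p (a ∷ []))) (ℕₚ.⊔-lub (ℕₚ.n≤1+n _) (s≤s z≤n))

length-*ₚ : ∀ p q → length (p *ₚ q) ≤ length p ℕ.+ length q
length-*ₚ []      q = z≤n
length-*ₚ (a ∷ p) q
  rewrite length-+ₚ (map (a *_) q) (+ 0 ∷ p *ₚ q) | length-map (a *_) q =
  ℕₚ.⊔-lub (ℕₚ.m≤n+m _ _) (s≤s (length-*ₚ p q))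

length-compose : ∀ p q → length (compose p q) ≤ length p ℕ.* suc (length q)
length-compose []       q = z≤n
length-compose (c ∷ cs) q rewrite length-+ₚ (c ∷ []) (q *ₚ compose cs q) =
  ℕₚ.⊔-lub (s≤s z≤n) (begin
    length (q *ₚ compose cs q)                 ≤⟨ length-*ₚ q (compose cs q) ⟩
    length q ℕ.+ length (compose cs q)         ≤⟨ ℕₚ.+-monoʳ-≤ (length q) (length-compose cs q) ⟩
    length q ℕ.+ length cs ℕ.* suc (length q)  ≤⟨ ℕₚ.n≤1+n _ ⟩
    length (c ∷ cs) ℕ.* suc (length q)         ∎)
  where open ℕₚ.≤-Reasoning

-- Coefficients and degrees

DegreeBelow : Poly → ℕ → Set
DegreeBelow p n = ∀ k → n ≤ k → coeff p k ≡ + 0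

DegreeBelow-mono : ∀ p {m n} → m ≤ n → DegreeBelow p m → DegreeBelow p n
DegreeBelow-mono p m≤n deg k n≤k = deg k (ℕₚ.≤-trans m≤n n≤k)

DegreeBelow-length : ∀ p → DegreeBelow p (length p)
DegreeBelow-length []      k       _         = refl
DegreeBelow-length (c ∷ p) (suc k) (s≤s n≤k) = DegreeBelow-length p k n≤k

coeff≢0⇒<length : ∀ p k → coeff p k ≢ + 0 → k < length p
coeff≢0⇒<length p k c≢0 with k ℕ.<? length p
... | yes k<n = k<n
... | no  k≮n = ⊥-elim (c≢0 (DegreeBelow-length p k (ℕₚ.≮⇒≥ k≮n)))

coeff-+ₚ : ∀ p q k → coeff (p +ₚ q) k ≡ coeff p k + coeff q k
coeff-+ₚ []      q       k       = sym (ℤₚ.+-identityˡ _)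
coeff-+ₚ (a ∷ p) []      k       = sym (ℤₚ.+-identityʳ _)
coeff-+ₚ (a ∷ p) (b ∷ q) zero    = refl
coeff-+ₚ (a ∷ p) (b ∷ q) (suc k) = coeff-+ₚ p q k

coeff-scale : ∀ a q k → coeff (map (a *_) q) k ≡ a * coeff q k
coeff-scale a []      k       = sym (ℤₚ.*-zeroʳ a)
coeff-scale a (b ∷ q) zero    = refl
coeff-scale a (b ∷ q) (suc k) = coeff-scale a q k

coeff-∷*ₚ-zero : ∀ a p q → coeff ((a ∷ p) *ₚ q) 0 ≡ a * coeff q 0
coeff-∷*ₚ-zero a p q = begin
  coeff (map (a *_) q +ₚ (+ 0 ∷ p *ₚ q)) 0   ≡⟨ coeff-+ₚ (map (a *_) q) _ 0 ⟩
  coeff (map (a *_) q) 0 + + 0               ≡⟨ ℤₚ.+-identityʳ _ ⟩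
  coeff (map (a *_) q) 0                     ≡⟨ coeff-scale a q 0 ⟩
  a * coeff q 0                              ∎
  where open ≡-Reasoning

coeff-∷*ₚ-suc : ∀ a p q k → coeff ((a ∷ p) *ₚ q) (suc k) ≡ a * coeff q (suc k) + coeff (p *ₚ q) k
coeff-∷*ₚ-suc a p q k =
  trans (coeff-+ₚ (map (a *_) q) _ (suc k)) (cong (_+ coeff (p *ₚ q) k) (coeff-scale a q (suc k)))

*ₚ-≈[] : ∀ p q → p ≈ₚ [] → (p *ₚ q) ≈ₚ []
*ₚ-≈[] []      q p≈0 k = refl
*ₚ-≈[] (a ∷ p) q p≈0 zero rewrite coeff-∷*ₚ-zero a p q | p≈0 0 = refl
*ₚ-≈[] (a ∷ p) q p≈0 (suc k)
  rewrite coeff-∷*ₚ-suc a p q k | p≈0 0 | *ₚ-≈[] p q (λ k → p≈0 (suc k)) k = refl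

coeff-*ₚ-top : ∀ p q i j → DegreeBelow p (suc i) → DegreeBelow q (suc j) →
  coeff (p *ₚ q) (i ℕ.+ j) ≡ coeff p i * coeff q j
coeff-*ₚ-top []      q i       j       _   _   = refl
coeff-*ₚ-top (a ∷ p) q zero    zero    _   _   = coeff-∷*ₚ-zero a p q
coeff-*ₚ-top (a ∷ p) q zero    (suc j) deg _
  rewrite coeff-∷*ₚ-suc a p q j | *ₚ-≈[] p q (λ k → deg (suc k) (s≤s z≤n)) j = ℤₚ.+-identityʳ _
coeff-*ₚ-top (a ∷ p) q (suc i) j       degp degq
  rewrite coeff-∷*ₚ-suc a p q (i ℕ.+ j) | degq (suc (i ℕ.+ j)) (s≤s (ℕₚ.m≤n+m j i))
        | coeff-*ₚ-top p q i j (λ k i<k → degp (suc k) (s≤s i<k)) degq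
        | ℤₚ.*-zeroʳ a = ℤₚ.+-identityˡ _

∷-HasDegree : ∀ {p d} a → HasDegree p d → HasDegree (a ∷ p) (suc d)
∷-HasDegree a (top≢0 , above) = top≢0 , λ { (suc k) (s≤s d<k) → above k d<k }

degree? : ∀ p → p ≈ₚ [] ⊎ ∃ (HasDegree p)
degree? []       = inj₁ (λ _ → refl)
degree? (c ∷ cs) with degree? cs
... | inj₂ (d , cs-degree) = inj₂ (suc d , ∷-HasDegree c cs-degree)
... | inj₁ cs≈0 with c ℤ.≟ + 0
...   | yes c≡0 = inj₁ λ { zero → c≡0 ; (suc k) → cs≈0 k }
...   | no  c≢0 = inj₂ (0 , c≢0 , λ { (suc k) _ → cs≈0 k })

monomial : ℕ → Poly
monomial zero    = + 1 ∷ []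
monomial (suc n) = + 0 ∷ monomial n

eval-monomial : ∀ n x → eval (monomial n) x ≡ x ^ n
eval-monomial zero    x = eval-const (+ 1) x
eval-monomial (suc n) x = trans (ℤₚ.+-identityˡ _) (cong (x *_) (eval-monomial n x))

eval-monomial-1 : ∀ x → eval (monomial 1) x ≡ x
eval-monomial-1 x = trans (eval-monomial 1 x) (ℤₚ.^-identityʳ x)

monomial-HasDegree : ∀ n → HasDegree (monomial n) n
monomial-HasDegree zero    = (λ ()) , λ { (suc k) _ → refl }
monomial-HasDegree (suc n) = ∷-HasDegree (+ 0) (monomial-HasDegree n)

-- Shifts, synthetic division and roots modulo an integer

shift : Poly → ℤ → Poly
shift p c = compose p (c ∷ + 1 ∷ [])

eval-shift : ∀ p c y → eval (shift p c) y ≡ eval p (c + y)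
eval-shift p c y = trans (eval-compose p _ y) (cong (eval p) (linear c y))
  where
  linear : ∀ c y → c + y * (+ 1 + y * + 0) ≡ c + y
  linear = solve-∀

length-shift : ∀ p c → length (shift p c) ≤ length p ℕ.* 3
length-shift p c = length-compose p (c ∷ + 1 ∷ [])

syntheticDiv : Poly → ℤ → Poly
syntheticDiv []       r = []
syntheticDiv (c ∷ cs) r = cs +ₚ map (r *_) (syntheticDiv cs r)

eval-syntheticDiv : ∀ p r y → eval p y ≡ eval p r + (y - r) * eval (syntheticDiv p r) y
eval-syntheticDiv []       r y = sym (trans (ℤₚ.+-identityˡ _) (ℤₚ.*-zeroʳ (y - r)))
eval-syntheticDiv (c ∷ cs) r y = begin
  c + y * eval cs y
    ≡⟨ cong (λ v → c + y * v) ih ⟩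
  c + y * (eval cs r + (y - r) * eval q y)
    ≡⟨ shuffle c y (eval cs r) (eval q y) r ⟩
  c + r * eval cs r + (y - r) * (eval cs r + (y - r) * eval q y + r * eval q y)
    ≡⟨ cong (λ v → c + r * eval cs r + (y - r) * (v + r * eval q y)) (sym ih) ⟩
  c + r * eval cs r + (y - r) * (eval cs y + r * eval q y)
    ≡⟨ cong (λ v → c + r * eval cs r + (y - r) * v) (sym eval-quotient) ⟩
  c + r * eval cs r + (y - r) * eval (syntheticDiv (c ∷ cs) r) y
    ∎
  where
  open ≡-Reasoning
  q : Poly
  q = syntheticDiv cs r
  ih : eval cs y ≡ eval cs r + (y - r) * eval q y
  ih = eval-syntheticDiv cs r y
  eval-quotient : eval (cs +ₚ map (r *_) q) y ≡ eval cs y + r * eval q y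
  eval-quotient = trans (eval-+ₚ cs _ y) (cong (_+_ (eval cs y)) (eval-scale r q y))
  shuffle : ∀ c y u w r → c + y * (u + (y - r) * w) ≡ c + r * u + (y - r) * (u + (y - r) * w + r * w)
  shuffle = solve-∀

length-syntheticDiv : ∀ p r → length (syntheticDiv p r) ≤ ℕ.pred (length p)
length-syntheticDiv []       r = z≤n
length-syntheticDiv (c ∷ cs) r
  rewrite length-+ₚ cs (map (r *_) (syntheticDiv cs r)) | length-map (r *_) (syntheticDiv cs r) =
  ℕₚ.⊔-lub ℕₚ.≤-refl (ℕₚ.≤-trans (length-syntheticDiv cs r) ℕₚ.pred[n]≤n)

eval-∣-cong : ∀ {m} p x y → m ∣ x - y → m ∣ eval p x - eval p y
eval-∣-cong p x y m∣x-y = subst (_ ∣_) (sym difference) (∣m⇒∣m*n _ m∣x-y)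
  where
  difference : eval p x - eval p y ≡ (x - y) * eval (syntheticDiv p y) x
  difference = trans (cong (_- eval p y) (eval-syntheticDiv p y x))
                     (cancel (eval p y) (x - y) (eval (syntheticDiv p y) x))
    where
    cancel : ∀ u w v → u + w * v - u ≡ w * v
    cancel = solve-∀

eval-∣-transport : ∀ {m} p {x y} → m ∣ x - y → m ∣ eval p x → m ∣ eval p y
eval-∣-transport {m} p {x} {y} m∣x-y m∣px =
  subst (m ∣_) (u-[u-v]≡v (eval p x) (eval p y)) (∣m∣n⇒∣m-n m∣px (eval-∣-cong p x y m∣x-y))
  where
  u-[u-v]≡v : ∀ u v → u - (u - v) ≡ v
  u-[u-v]≡v = solve-∀

∣shift⇒∣ : ∀ {m} p c → (∀ x → m ∣ eval (shift p c) x) → ∀ x → m ∣ eval p x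
∣shift⇒∣ {m} p c m∣shift x =
  subst (m ∣_) (trans (eval-shift p c (x - c)) (cong (eval p) (c+[x-c]≡x c x))) (m∣shift (x - c))
  where
  c+[x-c]≡x : ∀ c x → c + (x - c) ≡ x
  c+[x-c]≡x = solve-∀

∣0 : ∀ {m} → m ∣ + 0
∣0 = divides (+ 0) refl

Incongruent : ℤ → ℤ → ℤ → Set
Incongruent m x y = ¬ m ∣ x - y

module _ {m : ℤ} (euclid : ∀ a b → m ∣ a * b → (m ∣ a) ⊎ (m ∣ b)) where

  manyRoots⇒vanishes : ∀ p xs → AllPairs (Incongruent m) xs → length p ≤ length xs →
    All (λ x → m ∣ eval p x) xs → ∀ y → m ∣ eval p y
  manyRoots⇒vanishes [] [] _ _ _ y = ∣0
  manyRoots⇒vanishes p (r ∷ rs) (r≢rs ∷ rs-incongruent) length≤ (m∣pr ∷ m∣prs) y =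
    subst (m ∣_) (sym (eval-syntheticDiv p r y)) (∣m∣n⇒∣m+n m∣pr (∣n⇒∣m*n (y - r) (m∣q y)))
    where
    q : Poly
    q = syntheticDiv p r
    quotientRoot : ∀ {x} → Incongruent m r x × m ∣ eval p x → m ∣ eval q x
    quotientRoot {x} (r≢x , m∣px)
      with euclid (x - r) (eval q x) (∣m+n∣m⇒∣n (subst (m ∣_) (eval-syntheticDiv p r x) m∣px) m∣pr)
    ... | inj₂ m∣qx  = m∣qx
    ... | inj₁ m∣x-r = ⊥-elim (r≢x (subst (m ∣_) (negate x r) (∣m⇒∣-m m∣x-r)))
      where
      negate : ∀ x r → - (x - r) ≡ r - x
      negate = solve-∀
    m∣q : ∀ y → m ∣ eval q y
    m∣q = manyRoots⇒vanishes q rs rs-incongruent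
      (ℕₚ.≤-trans (length-syntheticDiv p r) (ℕₚ.pred-mono-≤ length≤))
      (All.zipWith quotientRoot (r≢rs , m∣prs))

0-euclid : ∀ a b → + 0 ∣ a * b → (+ 0 ∣ a) ⊎ (+ 0 ∣ b)
0-euclid a b 0∣ab with ℤₚ.i*j≡0⇒i≡0∨j≡0 a (0∣⇒≡0 0∣ab)
... | inj₁ refl = inj₁ ∣0
... | inj₂ refl = inj₂ ∣0

prime-euclid : ∀ {p} → Prime p → ∀ a b → + p ∣ a * b → (+ p ∣ a) ⊎ (+ p ∣ b)
prime-euclid {p} pp a b p∣ab
  with euclidsLemma ∣ a ∣ ∣ b ∣ pp (subst (p ℕᵈ.∣_) (ℤₚ.abs-* a b) (∣⇒∣ᵤ p∣ab))
... | inj₁ p∣a = inj₁ (∣ᵤ⇒∣ p∣a)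
... | inj₂ p∣b = inj₂ (∣ᵤ⇒∣ p∣b)

small-incongruent : ∀ {q} x y → x < q → y < q → x ≢ y → Incongruent (+ q) (+ x) (+ y)
small-incongruent {q} x y x<q y<q x≢y q∣x-y = ℕₚ.<⇒≱ ∣x-y∣<q (ℕᵈ.∣⇒≤ {{∣x-y∣≢0}} (∣⇒∣ᵤ q∣x-y))
  where
  ∣x-y∣<q : ∣ + x - + y ∣ < q
  ∣x-y∣<q = subst (_< q) (cong ∣_∣ (sym (ℤₚ.[+m]-[+n]≡m⊖n x y)))
              (ℕₚ.≤-<-trans (ℤₚ.∣m⊝n∣≤m⊔n x y) (ℕₚ.⊔-lub x<q y<q))
  ∣x-y∣≢0 : ℕ.NonZero ∣ + x - + y ∣
  ∣x-y∣≢0 = ℕ.≢-nonZero (x≢y ∘ ℤₚ.+-injective ∘ ℤₚ.i-j≡0⇒i≡j (+ x) (+ y) ∘ ℤₚ.∣i∣≡0⇒i≡0)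

-- Polynomials determined by their values

manyZeros⇒zero : ∀ p xs → Unique xs → length p ≤ length xs →
  All (λ x → eval p x ≡ + 0) xs → ∀ y → eval p y ≡ + 0
manyZeros⇒zero p xs unique length≤ zeros y =
  0∣⇒≡0 (manyRoots⇒vanishes 0-euclid p xs incongruent length≤
           (All.map (λ px≡0 → subst (_ ∣_) (sym px≡0) ∣0) zeros) y)
  where
  incongruent : AllPairs (Incongruent (+ 0)) xs
  incongruent = AllPairs.map (λ {x} {y} x≢y 0∣x-y → x≢y (ℤₚ.i-j≡0⇒i≡j x y (0∣⇒≡0 0∣x-y))) unique

eval≡0⇒≈[] : ∀ p → (∀ y → eval p y ≡ + 0) → p ≈ₚ []
eval≡0⇒≈[] []       _   = λ _ → refl
eval≡0⇒≈[] (c ∷ cs) p≡0 = λ { zero → c≡0 ; (suc k) → eval≡0⇒≈[] cs cs≡0 k }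
  where
  c≡0 : c ≡ + 0
  c≡0 = trans (sym (ℤₚ.+-identityʳ c)) (p≡0 (+ 0))
  nonzero : Fin (length cs) → ℤ
  nonzero i = + suc (toℕ i)
  y*cs≡0 : ∀ y → y * eval cs y ≡ + 0
  y*cs≡0 y = trans (sym (ℤₚ.+-identityˡ _)) (trans (cong (_+ y * eval cs y) (sym c≡0)) (p≡0 y))
  cs-zeroAt : ∀ i → eval cs (nonzero i) ≡ + 0
  cs-zeroAt i = [ (λ ()) , id ]′ (ℤₚ.i*j≡0⇒i≡0∨j≡0 (nonzero i) (y*cs≡0 (nonzero i)))
  cs≡0 : ∀ y → eval cs y ≡ + 0
  cs≡0 = manyZeros⇒zero cs (tabulate nonzero)
    (Unique.tabulate⁺ (λ eq → Finₚ.toℕ-injective (ℕₚ.suc-injective (ℤₚ.+-injective eq))))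
    (ℕₚ.≤-reflexive (sym (length-tabulate nonzero))) (All.tabulate⁺ cs-zeroAt)

IsConstant : Poly → ℤ → Set
IsConstant p c = coeff p 0 ≡ c × DegreeBelow p 1

eval-IsConstant : ∀ p {c} → IsConstant p c → ∀ x → eval p x ≡ c
eval-IsConstant p {c} (p₀≡c , deg) x = trans (eval-≈ₚ p (c ∷ []) p≈c x) (eval-const c x)
  where
  p≈c : p ≈ₚ (c ∷ [])
  p≈c zero    = p₀≡c
  p≈c (suc k) = deg (suc k) (s≤s z≤n)

take-≈ₚ : ∀ n p → DegreeBelow p n → take n p ≈ₚ p
take-≈ₚ zero    p       deg k       = sym (deg k z≤n)
take-≈ₚ (suc n) []      deg k       = refl
take-≈ₚ (suc n) (c ∷ p) deg zero    = refl
take-≈ₚ (suc n) (c ∷ p) deg (suc k) = take-≈ₚ n p (λ k n≤k → deg (suc k) (s≤s n≤k)) k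

agreesAtMany⇒IsConstant : ∀ p {n} c xs → DegreeBelow p n → Unique xs → n < length xs →
  All (λ x → eval p x ≡ c) xs → IsConstant p c
agreesAtMany⇒IsConstant p {n} c xs deg unique n<len agree = coeff₀ , higher
  where
  g : Poly
  g = take n p +ₚ (- c ∷ [])
  coeff-g : ∀ k → coeff g k ≡ coeff p k + coeff (- c ∷ []) k
  coeff-g k = trans (coeff-+ₚ (take n p) _ k) (cong (_+ coeff (- c ∷ []) k) (take-≈ₚ n p deg k))
  eval-g : ∀ x → eval g x ≡ eval p x - c
  eval-g x = trans (eval-+ₚ (take n p) _ x)
    (cong₂ _+_ (eval-≈ₚ (take n p) p (take-≈ₚ n p deg) x) (eval-const (- c) x))
  length-g : length g ≤ length xs
  length-g rewrite length-+ₚ (take n p) (- c ∷ []) | length-take n p =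
    ℕₚ.⊔-lub (ℕₚ.≤-trans (ℕₚ.m⊓n≤m n _) (ℕₚ.<⇒≤ n<len)) (ℕₚ.≤-trans (s≤s z≤n) n<len)
  g≈0 : g ≈ₚ []
  g≈0 = eval≡0⇒≈[] g (manyZeros⇒zero g xs unique length-g
          (All.map (λ {x} px≡c → trans (eval-g x) (ℤₚ.i≡j⇒i-j≡0 px≡c)) agree))
  coeff₀ : coeff p 0 ≡ c
  coeff₀ = ℤₚ.i-j≡0⇒i≡j _ _ (trans (sym (coeff-g 0)) (g≈0 0))
  higher : DegreeBelow p 1
  higher (suc k) _ = trans (sym (ℤₚ.+-identityʳ _)) (trans (sym (coeff-g (suc k))) (g≈0 (suc k)))

m+n<o+p⇒o≤m⇒n<p : ∀ {m n o p} → m ℕ.+ n < o ℕ.+ p → o ≤ m → n < p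
m+n<o+p⇒o≤m⇒n<p {m} {n} {o} {p} m+n<o+p o≤m =
  ℕₚ.+-cancelˡ-< m n p (ℕₚ.<-≤-trans m+n<o+p (ℕₚ.+-monoˡ-≤ p o≤m))

module _ {A : Set} where

  AllPairs-resp-⊆ : ∀ {R : A → A → Set} {xs ys} → ys ⊆ xs → AllPairs R xs → AllPairs R ys
  AllPairs-resp-⊆ []          []         = []
  AllPairs-resp-⊆ (x ∷ʳ ys⊆)  (_ ∷ Rxs)  = AllPairs-resp-⊆ ys⊆ Rxs
  AllPairs-resp-⊆ (refl ∷ ys⊆) (Rx ∷ Rxs) = All-resp-⊆ ys⊆ Rx ∷ AllPairs-resp-⊆ ys⊆ Rxs

  splitFirstClass : ∀ {t} {C : Fin (suc t) → A → Set} xs → All (λ x → ∃ λ j → C j x) xs →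
    ∃₂ λ ys zs → ys ⊆ xs × zs ⊆ xs × All (C Fin.zero) ys × All (λ x → ∃ λ j → C (Fin.suc j) x) zs ×
                 length ys ℕ.+ length zs ≡ length xs
  splitFirstClass [] [] = [] , [] , [] , [] , [] , [] , refl
  splitFirstClass (x ∷ xs) ((j , Cx) ∷ classes) with splitFirstClass xs classes | j
  ... | ys , zs , ys⊆ , zs⊆ , Cys , Czs , total | Fin.zero =
    x ∷ ys , zs , refl ∷ ys⊆ , x ∷ʳ zs⊆ , Cx ∷ Cys , Czs , cong suc total
  ... | ys , zs , ys⊆ , zs⊆ , Cys , Czs , total | Fin.suc j′ =
    ys , x ∷ zs , x ∷ʳ ys⊆ , refl ∷ zs⊆ , Cys , (j′ , Cx) ∷ Czs , trans (ℕₚ.+-suc _ _) (cong suc total)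

  pigeonhole : ∀ {t} {C : Fin t → A → Set} n xs → All (λ x → ∃ λ j → C j x) xs → t ℕ.* n < length xs →
    ∃₂ λ j ys → ys ⊆ xs × All (C j) ys × n < length ys
  pigeonhole {zero}  n (x ∷ xs) ((() , _) ∷ _) _
  pigeonhole {suc t} n xs classes t*n<len with splitFirstClass xs classes
  ... | ys , zs , ys⊆ , zs⊆ , Cys , Czs , total with n ℕ.<? length ys
  ...   | yes n<ys = Fin.zero , ys , ys⊆ , Cys , n<ys
  ...   | no  n≮ys
    with pigeonhole n zs Czs (m+n<o+p⇒o≤m⇒n<p (subst (_ <_) (sym total) t*n<len) (ℕₚ.≮⇒≥ n≮ys))
  ...     | j , us , us⊆ , Cus , n<us = Fin.suc j , us , ⊆-trans us⊆ zs⊆ , Cus , n<us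

∣i∣≡n⇒i≡±n : ∀ i {n} → ∣ i ∣ ≡ n → i ≡ + n ⊎ i ≡ - + n
∣i∣≡n⇒i≡±n (+ n)    refl = inj₁ refl
∣i∣≡n⇒i≡±n -[1+ n ] refl = inj₂ refl

absAgreesAtMany⇒IsConstant : ∀ p {n} c xs → DegreeBelow p n → Unique xs → 2 ℕ.* n < length xs →
  All (λ x → ∣ eval p x ∣ ≡ c) xs → ∃ λ v → ∣ v ∣ ≡ c × IsConstant p v
absAgreesAtMany⇒IsConstant p {n} c xs deg unique 2n<len agree =
  constantOnClass (pigeonhole n xs (All.map (λ {x} → signClass x) agree) 2n<len)
  where
  value : Fin 2 → ℤ
  value Fin.zero             = + c
  value (Fin.suc Fin.zero)   = - + c
  ∣value∣ : ∀ j → ∣ value j ∣ ≡ c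
  ∣value∣ Fin.zero           = refl
  ∣value∣ (Fin.suc Fin.zero) = ℤₚ.∣-i∣≡∣i∣ (+ c)
  signClass : ∀ x → ∣ eval p x ∣ ≡ c → ∃ λ j → eval p x ≡ value j
  signClass x ∣px∣≡c = [ (Fin.zero ,_) , (Fin.suc Fin.zero ,_) ]′ (∣i∣≡n⇒i≡±n _ ∣px∣≡c)
  constantOnClass : (∃₂ λ j ys → ys ⊆ xs × All (λ x → eval p x ≡ value j) ys × n < length ys) →
    ∃ λ v → ∣ v ∣ ≡ c × IsConstant p v
  constantOnClass (j , ys , ys⊆ , agree-ys , n<ys) =
    value j , ∣value∣ j ,
    agreesAtMany⇒IsConstant p (value j) ys deg (AllPairs-resp-⊆ ys⊆ unique) n<ys agree-ys

-- Prime values and irreducibility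

unitConstant⇒IsUnit : ∀ p → (∃ λ v → ∣ v ∣ ≡ 1 × IsConstant p v) → IsUnit p
unitConstant⇒IsUnit p (v , ∣v∣≡1 , p₀≡v , deg) =
  [ (λ v≡1 → inj₁ (trans p₀≡v v≡1)) , (λ v≡-1 → inj₂ (trans p₀≡v v≡-1)) ]′ (∣i∣≡n⇒i≡±n v ∣v∣≡1) , deg

IsPrimeℤ-* : ∀ a b → IsPrimeℤ (a * b) → ∣ a ∣ ≡ 1 ⊎ ∣ b ∣ ≡ 1
IsPrimeℤ-* a b ab-prime = [ inj₁ , inj₂ ∘ cancel ]′ (prime⇒irreducible ∣ab∣-prime (ℕᵈ.m∣m*n ∣ b ∣))
  where
  ∣ab∣-prime : Prime (∣ a ∣ ℕ.* ∣ b ∣)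
  ∣ab∣-prime = subst Prime (ℤₚ.abs-* a b) ab-prime
  instance
    ∣a∣≢0 : ℕ.NonZero ∣ a ∣
    ∣a∣≢0 = ℕ.≢-nonZero (λ ∣a∣≡0 → ¬prime[0] (subst Prime (cong (ℕ._* ∣ b ∣) ∣a∣≡0) ∣ab∣-prime))
  cancel : ∣ a ∣ ≡ ∣ a ∣ ℕ.* ∣ b ∣ → ∣ b ∣ ≡ 1
  cancel ∣a∣≡∣ab∣ = sym (ℕₚ.*-cancelˡ-≡ 1 ∣ b ∣ ∣ a ∣ (trans (ℕₚ.*-identityʳ ∣ a ∣) ∣a∣≡∣ab∣))

prime∣IsPrimeℤ⇒≡ : ∀ {q v} → Prime q → IsPrimeℤ v → + q ∣ v → ∣ v ∣ ≡ q
prime∣IsPrimeℤ⇒≡ q-prime v-prime q∣v with prime⇒irreducible v-prime (∣⇒∣ᵤ q∣v)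
... | inj₁ refl = ⊥-elim (¬prime[1] q-prime)
... | inj₂ q≡∣v∣ = sym q≡∣v∣

factors-DegreeBelow : ∀ F a b → F ≈ₚ (a *ₚ b) → ¬ (a ≈ₚ []) → ¬ (b ≈ₚ []) →
  DegreeBelow a (length F) × DegreeBelow b (length F)
factors-DegreeBelow F a b F≈ab a≉0 b≉0 with degree? a | degree? b
... | inj₁ a≈0 | _        = ⊥-elim (a≉0 a≈0)
... | inj₂ _   | inj₁ b≈0 = ⊥-elim (b≉0 b≈0)
... | inj₂ (i , aᵢ≢0 , deg-a) | inj₂ (j , bⱼ≢0 , deg-b) =
  DegreeBelow-mono a (ℕₚ.≤-trans (s≤s (ℕₚ.m≤m+n i j)) i+j<len) deg-a ,
  DegreeBelow-mono b (ℕₚ.≤-trans (s≤s (ℕₚ.m≤n+m j i)) i+j<len) deg-b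
  where
  top≢0 : coeff F (i ℕ.+ j) ≢ + 0
  top≢0 Fᵢ₊ⱼ≡0 = [ aᵢ≢0 , bⱼ≢0 ]′ (ℤₚ.i*j≡0⇒i≡0∨j≡0 (coeff a i)
    (trans (sym (coeff-*ₚ-top a b i j deg-a deg-b)) (trans (sym (F≈ab (i ℕ.+ j))) Fᵢ₊ⱼ≡0)))
  i+j<len : i ℕ.+ j < length F
  i+j<len = coeff≢0⇒<length F (i ℕ.+ j) top≢0

primeAtMany⇒irreducible : ∀ F xs → Unique xs → 4 ℕ.* length F < length xs →
  All (λ x → IsPrimeℤ (eval F x)) xs → Irreducible F
primeAtMany⇒irreducible F (x₀ ∷ xs) unique large primes@(Fx₀-prime ∷ _) = nonzero , nonunit , unitFactor
  where
  Fx₀≢0 : eval F x₀ ≢ + 0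
  Fx₀≢0 Fx₀≡0 = ¬prime[0] (subst IsPrimeℤ Fx₀≡0 Fx₀-prime)
  nonzero : ¬ (F ≈ₚ [])
  nonzero F≈0 = Fx₀≢0 (eval-≈ₚ[] F F≈0 x₀)
  nonunit : ¬ IsUnit F
  nonunit (F₀≡±1 , deg) =
    ¬prime[1] (subst Prime (trans (cong ∣_∣ (eval-IsConstant F (refl , deg) x₀)) (∣±1∣ F₀≡±1)) Fx₀-prime)
    where
    ∣±1∣ : ∀ {c} → c ≡ + 1 ⊎ c ≡ -[1+ 0 ] → ∣ c ∣ ≡ 1
    ∣±1∣ (inj₁ refl) = refl
    ∣±1∣ (inj₂ refl) = refl
  unitFactor : ∀ a b → F ≈ₚ (a *ₚ b) → IsUnit a ⊎ IsUnit b
  unitFactor a b F≈ab = unitOnClass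
    (pigeonhole (2 ℕ.* length F) (x₀ ∷ xs) (All.map (λ {x} → unitClass x) primes)
                (subst (_< length (x₀ ∷ xs)) (ℕₚ.*-assoc 2 2 (length F)) large))
    where
    eval-F : ∀ x → eval F x ≡ eval a x * eval b x
    eval-F x = trans (eval-≈ₚ F (a *ₚ b) F≈ab x) (eval-*ₚ a b x)
    factor : Fin 2 → Poly
    factor Fin.zero             = a
    factor (Fin.suc Fin.zero)   = b
    degrees : DegreeBelow a (length F) × DegreeBelow b (length F)
    degrees = factors-DegreeBelow F a b F≈ab
      (λ a≈0 → Fx₀≢0 (trans (eval-F x₀)
        (trans (cong (_* eval b x₀) (eval-≈ₚ[] a a≈0 x₀)) (ℤₚ.*-zeroˡ (eval b x₀)))))
      (λ b≈0 → Fx₀≢0 (trans (eval-F x₀)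
        (trans (cong (eval a x₀ *_) (eval-≈ₚ[] b b≈0 x₀)) (ℤₚ.*-zeroʳ (eval a x₀)))))
    degree : ∀ j → DegreeBelow (factor j) (length F)
    degree Fin.zero             = proj₁ degrees
    degree (Fin.suc Fin.zero)   = proj₂ degrees
    unitClass : ∀ x → IsPrimeℤ (eval F x) → ∃ λ j → ∣ eval (factor j) x ∣ ≡ 1
    unitClass x Fx-prime =
      [ (Fin.zero ,_) , (Fin.suc Fin.zero ,_) ]′
        (IsPrimeℤ-* (eval a x) (eval b x) (subst IsPrimeℤ (eval-F x) Fx-prime))
    unit : ∀ j → IsUnit (factor j) → IsUnit a ⊎ IsUnit b
    unit Fin.zero           = inj₁
    unit (Fin.suc Fin.zero) = inj₂
    unitOnClass : (∃₂ λ j ys → ys ⊆ x₀ ∷ xs × All (λ x → ∣ eval (factor j) x ∣ ≡ 1) ys ×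
                                2 ℕ.* length F < length ys) →
                  IsUnit a ⊎ IsUnit b
    unitOnClass (j , ys , ys⊆ , ∣factor∣≡1 , many) = unit j (unitConstant⇒IsUnit (factor j)
      (absAgreesAtMany⇒IsConstant (factor j) 1 ys (degree j) (AllPairs-resp-⊆ ys⊆ unique) many ∣factor∣≡1))

-- Infinite sets of integers

InfiniteSet-map : ∀ {S T : ℤ → Set} → (∀ {N} → S N → T N) → InfiniteSet S → InfiniteSet T
InfiniteSet-map S⇒T infinite B with infinite B
... | N , SN , B<∣N∣ = N , S⇒T SN , B<∣N∣

InfiniteSet-⊤ : InfiniteSet (λ _ → ⊤)
InfiniteSet-⊤ B = + suc B , tt , ℕₚ.≤-refl

InfiniteSet-translate : ∀ {S} → InfiniteSet S → ∀ c → InfiniteSet (λ y → S (c + y))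
InfiniteSet-translate {S} infinite c B with infinite (B ℕ.+ ∣ c ∣)
... | N , SN , B+∣c∣<∣N∣ = N - c , subst S (sym (c+[N-c]≡N c N)) SN , B<∣N-c∣
  where
  c+[N-c]≡N : ∀ c N → c + (N - c) ≡ N
  c+[N-c]≡N = solve-∀
  [N-c]+c≡N : ∀ c N → N - c + c ≡ N
  [N-c]+c≡N = solve-∀
  B<∣N-c∣ : B < ∣ N - c ∣
  B<∣N-c∣ = ℕₚ.+-cancelʳ-< ∣ c ∣ B _ (ℕₚ.<-≤-trans B+∣c∣<∣N∣
    (subst (λ v → ∣ v ∣ ≤ ∣ N - c ∣ ℕ.+ ∣ c ∣) ([N-c]+c≡N c N) (ℤₚ.∣i+j∣≤∣i∣+∣j∣ (N - c) c)))

InfiniteSet⇒Unique : ∀ {S} → InfiniteSet S → ∀ n → ∃ λ xs → Unique xs × All S xs × length xs ≡ n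
InfiniteSet⇒Unique {S} infinite n = forgetBound (bounded n)
  where
  bounded : ∀ n → ∃₂ λ xs B → Unique xs × All S xs × All (λ x → ∣ x ∣ ≤ B) xs × length xs ≡ n
  bounded zero = [] , 0 , [] , [] , [] , refl
  bounded (suc n) with bounded n
  ... | xs , B , unique , Sxs , ∣xs∣≤B , length≡n with infinite B
  ...   | N , SN , B<∣N∣ =
    N ∷ xs , ∣ N ∣ ,
    All.map (λ ∣x∣≤B N≡x → ℕₚ.<⇒≱ B<∣N∣ (subst (λ v → ∣ v ∣ ≤ B) (sym N≡x) ∣x∣≤B)) ∣xs∣≤B ∷ unique ,
    SN ∷ Sxs ,
    ℕₚ.≤-refl ∷ All.map (λ ∣x∣≤B → ℕₚ.≤-trans ∣x∣≤B (ℕₚ.<⇒≤ B<∣N∣)) ∣xs∣≤B ,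
    cong suc length≡n
  forgetBound : (∃₂ λ xs B → Unique xs × All S xs × All (λ x → ∣ x ∣ ≤ B) xs × length xs ≡ n) →
    ∃ λ xs → Unique xs × All S xs × length xs ≡ n
  forgetBound (xs , _ , unique , Sxs , _ , length≡n) = xs , unique , Sxs , length≡n

primeAtInfinitelyMany⇒irreducible : ∀ F → InfiniteSet (λ x → IsPrimeℤ (eval F x)) → Irreducible F
primeAtInfinitelyMany⇒irreducible F infinite with InfiniteSet⇒Unique infinite (suc (4 ℕ.* length F))
... | xs , unique , primes , length≡ =
  primeAtMany⇒irreducible F xs unique (ℕₚ.≤-reflexive (sym length≡)) primes

constantOnInfinite : ∀ {S} p {v} → InfiniteSet S → (∀ {x} → S x → eval p x ≡ v) → ∀ x → eval p x ≡ v
constantOnInfinite p {v} infinite agree with InfiniteSet⇒Unique infinite (suc (length p))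
... | xs , unique , Sxs , length≡ = eval-IsConstant p (agreesAtMany⇒IsConstant p v xs
  (DegreeBelow-length p) unique (ℕₚ.≤-reflexive (sym length≡)) (All.map agree Sxs))

Coercive : (ℤ → ℤ) → Set
Coercive f = ∃ λ C → ∀ y → ∣ y ∣ ≤ ∣ f y ∣ ℕ.+ C

Coercive-resp-≗ : ∀ {f g} → (∀ y → f y ≡ g y) → Coercive f → Coercive g
Coercive-resp-≗ f≗g (C , bound) = C , λ y → subst (λ v → ∣ y ∣ ≤ ∣ v ∣ ℕ.+ C) (f≗g y) (bound y)

coercive-+ : ∀ {f} a → Coercive f → Coercive (λ y → f y + a)
coercive-+ {f} a (C , bound) = C ℕ.+ ∣ a ∣ , λ y → begin
  ∣ y ∣                           ≤⟨ bound y ⟩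
  ∣ f y ∣ ℕ.+ C                   ≤⟨ ℕₚ.+-monoˡ-≤ C (∣f∣≤ y) ⟩
  ∣ f y + a ∣ ℕ.+ ∣ a ∣ ℕ.+ C     ≡⟨ ℕₚ.+-assoc ∣ f y + a ∣ ∣ a ∣ C ⟩
  ∣ f y + a ∣ ℕ.+ (∣ a ∣ ℕ.+ C)   ≡⟨ cong (ℕ._+_ ∣ f y + a ∣) (ℕₚ.+-comm ∣ a ∣ C) ⟩
  ∣ f y + a ∣ ℕ.+ (C ℕ.+ ∣ a ∣)   ∎
  where
  open ℕₚ.≤-Reasoning
  cancel : ∀ u a → u + a - a ≡ u
  cancel = solve-∀
  ∣f∣≤ : ∀ y → ∣ f y ∣ ≤ ∣ f y + a ∣ ℕ.+ ∣ a ∣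
  ∣f∣≤ y = subst (λ v → ∣ v ∣ ≤ ∣ f y + a ∣ ℕ.+ ∣ a ∣) (cancel (f y) a) (ℤₚ.∣i-j∣≤∣i∣+∣j∣ (f y + a) a)

∣i∣≤∣i^1+n∣ : ∀ i n → ∣ i ∣ ≤ ∣ i ^ suc n ∣
∣i∣≤∣i^1+n∣ i n with i ℤ.≟ + 0
... | yes refl = z≤n
... | no  i≢0  = subst (∣ i ∣ ≤_) (sym (ℤₚ.abs-* i (i ^ n))) (ℕₚ.m≤m*n ∣ i ∣ ∣ i ^ n ∣ {{∣i^n∣≢0}})
  where
  ∣i^n∣≢0 : ℕ.NonZero ∣ i ^ n ∣
  ∣i^n∣≢0 = ℕ.≢-nonZero (i≢0 ∘ ℤₚ.i^n≡0⇒i≡0 i n ∘ ℤₚ.∣i∣≡0⇒i≡0)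

coercive-^ : ∀ {f} n → Coercive f → Coercive (λ y → f y ^ suc n)
coercive-^ {f} n (C , bound) = C , λ y → ℕₚ.≤-trans (bound y) (ℕₚ.+-monoˡ-≤ C (∣i∣≤∣i^1+n∣ (f y) n))

coercive-image : ∀ {f S} → Coercive f → InfiniteSet S → InfiniteSet (λ N → ∃ λ k → S k × f k ≡ N)
coercive-image {f} (C , bound) infinite B with infinite (B ℕ.+ C)
... | k , Sk , B+C<∣k∣ = f k , (k , Sk , refl) , ℕₚ.+-cancelʳ-< C B _ (ℕₚ.<-≤-trans B+C<∣k∣ (bound k))

-- Fixed divisors

NoPrimeFixedDivisor : Poly → Set
NoPrimeFixedDivisor G = ∀ {q} → Prime q → ¬ (∀ x → + q ∣ eval G x)

noFixedDivisor⇒noPrimeFixedDivisor : ∀ G → NoFixedDivisor G → NoPrimeFixedDivisor G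
noFixedDivisor⇒noPrimeFixedDivisor G noFixed {q} q-prime q∣G =
  noFixed (+ q) (q≢0 ∘ cong ∣_∣ , q≢1 ∘ cong ∣_∣ , (λ ()) , ∣⇒∣ᵤ ∘ q∣G)
  where
  q≢0 : q ≢ 0
  q≢0 refl = ¬prime[0] q-prime
  q≢1 : q ≢ 1
  q≢1 refl = ¬prime[1] q-prime

primeFactor : ∀ n → 2 ≤ n → ∃ λ p → Prime p × p ℕᵈ.∣ n
primeFactor 1 (s≤s ())
primeFactor n@(suc (suc _)) _ with factorise n
... | record { factors = p ∷ ps ; isFactorisation = n≡p*ps ; factorsPrime = p-prime ∷ _ } =
  p , p-prime , subst (p ℕᵈ.∣_) (sym n≡p*ps) (ℕᵈ.m∣m*n (product ps))

2≤∣i∣ : ∀ i → i ≢ + 0 → i ≢ + 1 → i ≢ -[1+ 0 ] → 2 ≤ ∣ i ∣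
2≤∣i∣ (+ 0)           i≢0 _   _    = ⊥-elim (i≢0 refl)
2≤∣i∣ (+ 1)           _   i≢1 _    = ⊥-elim (i≢1 refl)
2≤∣i∣ (+ suc (suc _)) _   _   _    = s≤s (s≤s z≤n)
2≤∣i∣ -[1+ 0 ]        _   _   i≢-1 = ⊥-elim (i≢-1 refl)
2≤∣i∣ -[1+ suc _ ]    _   _   _    = s≤s (s≤s z≤n)

noPrimeFixedDivisor⇒noFixedDivisor : ∀ G → NoPrimeFixedDivisor G → NoFixedDivisor G
noPrimeFixedDivisor⇒noFixedDivisor G noPrime a (a≢0 , a≢1 , a≢-1 , a∣G)
  with primeFactor ∣ a ∣ (2≤∣i∣ a a≢0 a≢1 a≢-1)
... | q , q-prime , q∣a = noPrime q-prime (λ x → ∣ᵤ⇒∣ (ℕᵈ.∣-trans q∣a (a∣G x)))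

∣factor⇒∣prodₚ : ∀ {s} (P : Fin s → Poly) {m} i x → m ∣ eval (P i) x → m ∣ eval (prodₚ P) x
∣factor⇒∣prodₚ P Fin.zero x m∣Pᵢx =
  subst (_ ∣_) (sym (eval-*ₚ (P Fin.zero) _ x)) (∣m⇒∣m*n (eval (prodₚ (P ∘ Fin.suc)) x) m∣Pᵢx)
∣factor⇒∣prodₚ P (Fin.suc i) x m∣Pᵢx =
  subst (_ ∣_) (sym (eval-*ₚ (P Fin.zero) _ x))
    (∣n⇒∣m*n (eval (P Fin.zero) x) (∣factor⇒∣prodₚ (P ∘ Fin.suc) i x m∣Pᵢx))

prime∣prodₚ⇒∣factor : ∀ {s} (P : Fin s → Poly) {q} → Prime q → ∀ x → + q ∣ eval (prodₚ P) x →
  ∃ λ i → + q ∣ eval (P i) x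
prime∣prodₚ⇒∣factor {zero} P {q} q-prime x q∣1 =
  ⊥-elim (¬prime[1] (subst Prime q≡1 q-prime))
  where
  q≡1 : q ≡ 1
  q≡1 = ℕᵈ.∣1⇒≡1 (subst (_ ℕᵈ.∣_) (cong ∣_∣ (eval-const (+ 1) x)) (∣⇒∣ᵤ q∣1))
prime∣prodₚ⇒∣factor {suc s} P q-prime x q∣P
  with prime-euclid q-prime (eval (P Fin.zero) x) _ (subst (_ ∣_) (eval-*ₚ (P Fin.zero) _ x) q∣P)
... | inj₁ q∣P₀x   = Fin.zero , q∣P₀x
... | inj₂ q∣rest with prime∣prodₚ⇒∣factor (P ∘ Fin.suc) q-prime x q∣rest
...   | i , q∣Pᵢx = Fin.suc i , q∣Pᵢx

largePrimeFixedDivisor⇒factor : ∀ {t} (R : Fin t → Poly) {T q} → (∀ j → length (R j) ≤ T) → Prime q →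
  t ℕ.* T < q → (∀ x → + q ∣ eval (prodₚ R) x) → ∃ λ j → ∀ x → + q ∣ eval (R j) x
largePrimeFixedDivisor⇒factor {t} R {T} {q} length≤T q-prime tT<q q∣R =
  vanishingFactor (pigeonhole T points (All.tabulate⁺ rootClass) tT<length)
  where
  point : Fin (suc (t ℕ.* T)) → ℤ
  point k = + toℕ k
  points : List ℤ
  points = tabulate point
  tT<length : t ℕ.* T < length points
  tT<length = ℕₚ.≤-reflexive (sym (length-tabulate point))
  rootClass : ∀ k → ∃ λ j → + q ∣ eval (R j) (point k)
  rootClass k = prime∣prodₚ⇒∣factor R q-prime (point k) (q∣R (point k))
  point<q : ∀ k → toℕ k < q
  point<q k = ℕₚ.≤-<-trans (ℕₚ.≤-pred (Finₚ.toℕ<n k)) tT<q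
  incongruent : AllPairs (Incongruent (+ q)) points
  incongruent = AllPairs.tabulate⁺ {f = point} λ {k} {l} k≢l →
    small-incongruent (toℕ k) (toℕ l) (point<q k) (point<q l) (k≢l ∘ Finₚ.toℕ-injective)
  vanishingFactor : (∃₂ λ j ys → ys ⊆ points × All (λ x → + q ∣ eval (R j) x) ys × T < length ys) →
    ∃ λ j → ∀ x → + q ∣ eval (R j) x
  vanishingFactor (j , ys , ys⊆ , roots , T<length) =
    j , manyRoots⇒vanishes (prime-euclid q-prime) (R j) ys (AllPairs-resp-⊆ ys⊆ incongruent)
          (ℕₚ.≤-trans (length≤T j) (ℕₚ.<⇒≤ T<length)) roots

-- The construction

upperBound : ∀ {s} (f : Fin s → ℕ) → ∃ λ B → ∀ i → f i ≤ B
upperBound {zero}  f = 0 , λ ()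
upperBound {suc s} f with upperBound (f ∘ Fin.suc)
... | B , bound = f Fin.zero ⊔ B ,
  λ { Fin.zero → ℕₚ.m≤m⊔n _ B ; (Fin.suc i) → ℕₚ.≤-trans (bound i) (ℕₚ.m≤n⊔m _ B) }

module Construction (SH : SchinzelHypothesis) {s} (P : Fin s → Poly)
  (P-irreducible : ∀ i → Irreducible (P i)) (P-noFixedDivisor : NoFixedDivisor (prodₚ P)) where

  PrimeTuplesInImage : (ℤ → ℤ) → Set
  PrimeTuplesInImage f = InfiniteSet (λ N → (∃ λ k → f k ≡ N) × (∀ i → IsPrimeℤ (eval (P i) N)))

  PrimeTuplesInImage-resp-≗ : ∀ {f g} → (∀ y → f y ≡ g y) → PrimeTuplesInImage f → PrimeTuplesInImage g
  PrimeTuplesInImage-resp-≗ f≗g =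
    InfiniteSet-map λ { ((k , fk≡N) , primes) → (k , trans (sym (f≗g k)) fk≡N) , primes }

  P-noPrimeFixedDivisor : NoPrimeFixedDivisor (prodₚ P)
  P-noPrimeFixedDivisor = noFixedDivisor⇒noPrimeFixedDivisor (prodₚ P) P-noFixedDivisor

  factor-noPrimeFixedDivisor : ∀ {q} → Prime q → ∀ i → ¬ (∀ x → + q ∣ eval (P i) x)
  factor-noPrimeFixedDivisor q-prime i q∣Pᵢ =
    P-noPrimeFixedDivisor q-prime (λ x → ∣factor⇒∣prodₚ P i x (q∣Pᵢ x))

  -- The shift inherits the infinitely many prime values that Schinzel's hypothesis gives P i.
  shift-irreducible : ∀ i c → Irreducible (shift (P i) c)
  shift-irreducible i c = primeAtInfinitelyMany⇒irreducible (shift (P i) c)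
    (InfiniteSet-map (λ {y} primes → subst IsPrimeℤ (sym (eval-shift (P i) c y)) (primes i))
      (InfiniteSet-translate (SH s P P-irreducible P-noFixedDivisor) c))

  ℓ : ℕ
  ℓ = proj₁ (upperBound (length ∘ P))

  length-P : ∀ i → length (P i) ≤ ℓ
  length-P = proj₂ (upperBound (length ∘ P))

  module Translate (W : Poly) where

    -- D bounds the lengths of the F i below, K is large enough for the counting arguments on
    -- the F i, and L bounds the number of roots of the shifts R j taken together.
    D K L : ℕ
    D = ℓ ℕ.* suc (suc (length W))
    K = suc ((2 ℕ.+ s) ℕ.* (2 ℕ.* D))
    L = (K ℕ.* s) ℕ.* (ℓ ℕ.* 3)

    point : Fin K → ℤ
    point k = + (suc (toℕ k) ℕ.* L !)

    shiftedFactor : Fin K → Fin s → Poly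
    shiftedFactor k i = shift (P i) (eval W (point k))

    R : Fin (K ℕ.* s) → Poly
    R j = uncurry shiftedFactor (remQuot s j)

    length-R : ∀ j → length (R j) ≤ ℓ ℕ.* 3
    length-R j = ℕₚ.≤-trans (length-shift (P _) _) (ℕₚ.*-monoˡ-≤ 3 (length-P _))

    smallPrime∣point : ∀ {q} → Prime q → q ≤ L → ∀ k → + q ∣ point k
    smallPrime∣point q-prime q≤L k =
      ∣ᵤ⇒∣ (ℕᵈ.∣-trans (ℕᵈ.∣-trans (n∣n! {{prime⇒nonZero q-prime}}) (ℕᵈ.m≤n⇒m!∣n! q≤L))
                      (ℕᵈ.n∣m*n (suc (toℕ k))))
      where
      n∣n! : ∀ {n} → .{{ℕ.NonZero n}} → n ℕᵈ.∣ n !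
      n∣n! {suc n} = ℕᵈ.m∣m*n (n !)

    smallPrimeFixedDivisor : ∀ {q} → Prime q → q ≤ L →
      (∀ x → + q ∣ eval (prodₚ R) x) → ∀ x → + q ∣ eval (prodₚ P) x
    smallPrimeFixedDivisor {q} q-prime q≤L q∣R x =
      uncurry undoShift (prime∣prodₚ⇒∣factor R q-prime (x - c₀) (q∣R (x - c₀)))
      where
      c₀ : ℤ
      c₀ = eval W (+ 0)
      undoShift : ∀ j → + q ∣ eval (R j) (x - c₀) → + q ∣ eval (prodₚ P) x
      undoShift j q∣Rⱼ = ∣factor⇒∣prodₚ P i x
        (eval-∣-transport (P i) congruent (subst (+ q ∣_) (eval-shift (P i) cₖ (x - c₀)) q∣Rⱼ))
        where
        k : Fin K
        k = proj₁ (remQuot s j)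
        i : Fin s
        i = proj₂ (remQuot s j)
        cₖ : ℤ
        cₖ = eval W (point k)
        shifted : ∀ cₖ x c₀ → cₖ + (x - c₀) - x ≡ cₖ - c₀
        shifted = solve-∀
        congruent : + q ∣ cₖ + (x - c₀) - x
        congruent = subst (+ q ∣_) (sym (shifted cₖ x c₀)) (eval-∣-cong W (point k) (+ 0)
          (subst (+ q ∣_) (sym (ℤₚ.+-identityʳ (point k))) (smallPrime∣point q-prime q≤L k)))

    R-noPrimeFixedDivisor : NoPrimeFixedDivisor (prodₚ R)
    R-noPrimeFixedDivisor {q} q-prime q∣R = [ small , large ]′ (ℕₚ.≤-<-connex q L)
      where
      small : q ≤ L → ⊥
      small q≤L = P-noPrimeFixedDivisor q-prime (smallPrimeFixedDivisor q-prime q≤L q∣R)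
      large : L < q → ⊥
      large L<q = uncurry (λ j q∣Rⱼ → factor-noPrimeFixedDivisor q-prime _ (∣shift⇒∣ (P _) _ q∣Rⱼ))
                          (largePrimeFixedDivisor⇒factor R length-R q-prime L<q q∣R)

    -- Opaque, so that conversion checking never unfolds Schinzel's witness.
    opaque
      schinzel-R : ∃ λ a → (∀ j → IsPrimeℤ (eval (R j) a)) × 0 < ∣ a ∣
      schinzel-R = SH (K ℕ.* s) R (λ j → shift-irreducible _ _)
                     (noPrimeFixedDivisor⇒noFixedDivisor (prodₚ R) R-noPrimeFixedDivisor) 0

    offset : ℤ
    offset = proj₁ schinzel-R

    R-prime : ∀ j → IsPrimeℤ (eval (R j) offset)
    R-prime = proj₁ (proj₂ schinzel-R)

    Q : Poly
    Q = W +ₚ (offset ∷ [])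

    eval-Q : ∀ y → eval Q y ≡ eval W y + offset
    eval-Q y = trans (eval-+ₚ W (offset ∷ []) y) (cong (_+_ (eval W y)) (eval-const offset y))

    F : Fin s → Poly
    F i = compose (P i) Q

    eval-F : ∀ i y → eval (F i) y ≡ eval (P i) (eval W y + offset)
    eval-F i y = trans (eval-compose (P i) Q y) (cong (eval (P i)) (eval-Q y))

    F-prime : ∀ i k → IsPrimeℤ (eval (F i) (point k))
    F-prime i k = subst IsPrimeℤ (sym (eval-F i (point k))) Pᵢ-prime
      where
      Pᵢ-prime : IsPrimeℤ (eval (P i) (eval W (point k) + offset))
      Pᵢ-prime = subst IsPrimeℤ (eval-shift (P i) (eval W (point k)) offset)
        (subst (λ Rⱼ → IsPrimeℤ (eval Rⱼ offset))
          (cong (uncurry shiftedFactor) (Finₚ.remQuot-combine k i)) (R-prime (combine k i)))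

    length-F : ∀ i → length (F i) ≤ D
    length-F i =
      ℕₚ.≤-trans (length-compose (P i) Q) (ℕₚ.*-mono-≤ (length-P i) (s≤s (length-+ₚ-const W offset)))

    points : List ℤ
    points = tabulate point

    points-unique : Unique points
    points-unique = Unique.tabulate⁺ λ pₖ≡pₗ → Finₚ.toℕ-injective
      (ℕₚ.suc-injective (ℕₚ.*-cancelʳ-≡ _ _ (L !) {{L ℕₚ.!≢0}} (ℤₚ.+-injective pₖ≡pₗ)))

    length-points : length points ≡ K
    length-points = length-tabulate point

    F-irreducible : ∀ i → Irreducible (F i)
    F-irreducible i =
      primeAtMany⇒irreducible (F i) points points-unique 4len<K (All.tabulate⁺ (F-prime i))
      where
      4len<K : 4 ℕ.* length (F i) < length points
      4len<K = subst (4 ℕ.* length (F i) <_) (sym length-points) (s≤s (begin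
        4 ℕ.* length (F i)       ≤⟨ ℕₚ.*-monoʳ-≤ 4 (length-F i) ⟩
        2 ℕ.* 2 ℕ.* D            ≡⟨ ℕₚ.*-assoc 2 2 D ⟩
        2 ℕ.* (2 ℕ.* D)          ≤⟨ ℕₚ.*-monoˡ-≤ (2 ℕ.* D) (ℕₚ.m≤m+n 2 s) ⟩
        (2 ℕ.+ s) ℕ.* (2 ℕ.* D)  ∎))
        where open ℕₚ.≤-Reasoning

    P-constantOnImage : Coercive (eval Q) → ∀ i {v} → IsConstant (F i) v → ∀ x → eval (P i) x ≡ v
    P-constantOnImage coercive i constant =
      constantOnInfinite (P i) (coercive-image coercive InfiniteSet-⊤)
        λ { (y , _ , refl) → trans (sym (eval-compose (P i) Q y)) (eval-IsConstant (F i) constant y) }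

    F-noPrimeFixedDivisor : Coercive (eval Q) → NoPrimeFixedDivisor (prodₚ F)
    F-noPrimeFixedDivisor coercive {q} q-prime q∣F =
      constantFactor (pigeonhole (2 ℕ.* D) points (All.tabulate⁺ primeClass) s2D<K)
      where
      primeClass : ∀ k → ∃ λ i → ∣ eval (F i) (point k) ∣ ≡ q
      primeClass k = map₂ (λ {i} → prime∣IsPrimeℤ⇒≡ q-prime (F-prime i k))
                          (prime∣prodₚ⇒∣factor F q-prime (point k) (q∣F (point k)))
      s2D<K : s ℕ.* (2 ℕ.* D) < length points
      s2D<K = subst (s ℕ.* (2 ℕ.* D) <_) (sym length-points)
                (s≤s (ℕₚ.*-monoˡ-≤ (2 ℕ.* D) (ℕₚ.m≤n+m s 2)))
      noConstantValue : ∀ i → ¬ (∃ λ v → ∣ v ∣ ≡ q × IsConstant (F i) v)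
      noConstantValue i (v , ∣v∣≡q , constant) = factor-noPrimeFixedDivisor q-prime i λ x →
        subst (+ q ∣_) (sym (P-constantOnImage coercive i constant x)) (subst (λ n → + n ∣ v) ∣v∣≡q ∣m∣∣m)
      constantFactor : ¬ (∃₂ λ i ys → ys ⊆ points × All (λ x → ∣ eval (F i) x ∣ ≡ q) ys ×
                                      2 ℕ.* D < length ys)
      constantFactor (i , ys , ys⊆ , ∣Fᵢ∣≡q , many) = noConstantValue i (absAgreesAtMany⇒IsConstant (F i) q ys
        (DegreeBelow-mono (F i) (length-F i) (DegreeBelow-length (F i)))
        (AllPairs-resp-⊆ ys⊆ points-unique) many ∣Fᵢ∣≡q)

    translate-primeTuples : Coercive (eval W) → PrimeTuplesInImage (λ y → eval W y + offset)
    translate-primeTuples coercive-W = PrimeTuplesInImage-resp-≗ eval-Q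
      (InfiniteSet-map primeTuple (coercive-image coercive-Q (SH s F F-irreducible F-noFixedDivisor)))
      where
      coercive-Q : Coercive (eval Q)
      coercive-Q = Coercive-resp-≗ (sym ∘ eval-Q) (coercive-+ {eval W} offset coercive-W)
      F-noFixedDivisor : NoFixedDivisor (prodₚ F)
      F-noFixedDivisor = noPrimeFixedDivisor⇒noFixedDivisor (prodₚ F) (F-noPrimeFixedDivisor coercive-Q)
      primeTuple : ∀ {N} → (∃ λ k → (∀ i → IsPrimeℤ (eval (F i) k)) × eval Q k ≡ N) →
        (∃ λ k → eval Q k ≡ N) × (∀ i → IsPrimeℤ (eval (P i) N))
      primeTuple (k , Fₖ-prime , refl) = (k , refl) , λ i → subst IsPrimeℤ (eval-compose (P i) Q k) (Fₖ-prime i)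

  module Tower (e : ℕ → ℕ) where

    -- a ∷ monomial e is the polynomial T^(e+1) + a.
    nextFactor : ℕ → Poly → Poly
    nextFactor m Q = Translate.offset (compose (monomial (suc (e m))) Q) ∷ monomial (e m)

    composite : ℕ → Poly
    composite zero    = monomial 1
    composite (suc m) = compose (nextFactor m (composite m)) (composite m)

    M : ℕ → Poly
    M m = nextFactor m (composite m)

    M-HasDegree : ∀ m → HasDegree (M m) (suc (e m))
    M-HasDegree m = ∷-HasDegree _ (monomial-HasDegree (e m))

    eval-iterComp : ∀ m y → eval (iterComp M m) y ≡ eval (composite (suc m)) y
    eval-iterComp zero    y =
      sym (trans (eval-compose (M 0) (composite 0) y) (cong (eval (M 0)) (eval-monomial-1 y)))
    eval-iterComp (suc m) y = begin
      eval (iterComp M (suc m)) y                       ≡⟨ eval-compose (M (suc m)) (iterComp M m) y ⟩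
      eval (M (suc m)) (eval (iterComp M m) y)          ≡⟨ cong (eval (M (suc m))) (eval-iterComp m y) ⟩
      eval (M (suc m)) (eval (composite (suc m)) y)     ≡⟨ eval-compose (M (suc m)) (composite (suc m)) y ⟨
      eval (composite (suc (suc m))) y                  ∎
      where open ≡-Reasoning

    step : ∀ m Q → Coercive (eval Q) →
      Coercive (eval (compose (nextFactor m Q) Q)) × PrimeTuplesInImage (eval (compose (nextFactor m Q) Q))
    step m Q coercive-Q =
      Coercive-resp-≗ translated (coercive-+ {eval W} a coercive-W) ,
      PrimeTuplesInImage-resp-≗ translated (Translate.translate-primeTuples W coercive-W)
      where
      W : Poly
      W = compose (monomial (suc (e m))) Q
      a : ℤ
      a = Translate.offset W
      coercive-W : Coercive (eval W)
      coercive-W = Coercive-resp-≗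
        (λ y → sym (trans (eval-compose (monomial (suc (e m))) Q y) (eval-monomial (suc (e m)) (eval Q y))))
        (coercive-^ {eval Q} (e m) coercive-Q)
      translated : ∀ y → eval W y + a ≡ eval (compose (nextFactor m Q) Q) y
      translated y = begin
        eval W y + a
          ≡⟨ cong (_+ a) (eval-compose (monomial (suc (e m))) Q y) ⟩
        + 0 + eval Q y * eval (monomial (e m)) (eval Q y) + a
          ≡⟨ swap a (eval Q y * eval (monomial (e m)) (eval Q y)) ⟩
        a + eval Q y * eval (monomial (e m)) (eval Q y)
          ≡⟨ sym (eval-compose (nextFactor m Q) Q y) ⟩
        eval (compose (nextFactor m Q) Q) y
          ∎
        where
        open ≡-Reasoning
        swap : ∀ a t → + 0 + t + a ≡ a + t
        swap = solve-∀

    composite-coercive : ∀ m → Coercive (eval (composite m))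
    composite-coercive zero    = Coercive-resp-≗ (sym ∘ eval-monomial-1) (0 , λ y → ℕₚ.m≤m+n ∣ y ∣ 0)
    composite-coercive (suc m) = proj₁ (step m (composite m) (composite-coercive m))

    composite-primeTuples : ∀ m → PrimeTuplesInImage (eval (iterComp M m))
    composite-primeTuples m =
      PrimeTuplesInImage-resp-≗ (sym ∘ eval-iterComp m) (proj₂ (step m (composite m) (composite-coercive m)))

corollary1p4 : SchinzelHypothesis →
    ∀ (s : ℕ) (P : Fin s → Poly) →
    (∀ i → Irreducible (P i)) →
    NoFixedDivisor (prodₚ P) →
    ∀ (d : ℕ → ℕ) → (∀ m → 1 ≤ d m) →
    Σ (ℕ → Poly) λ M →
      (∀ m → HasDegree (M m) (d m)) ×
      (∀ m → InfiniteSet (λ N →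
        (∃ λ (k : ℤ) → eval (iterComp M m) k ≡ N) ×
        (∀ i → IsPrimeℤ (eval (P i) N))))
corollary1p4 SH s P P-irreducible P-noFixedDivisor d 1≤d =
  M ,
  (λ m → subst (HasDegree (M m)) (ℕₚ.suc-pred (d m) {{ℕ.>-nonZero (1≤d m)}}) (M-HasDegree m)) ,
  composite-primeTuples
  where
  open Construction SH P P-irreducible P-noFixedDivisor
  open Tower (ℕ.pred ∘ d)
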